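{- Let $\mathbf{P}\colon\mathsf{C}^{\mathrm{op}}\to\mathsf{BA}$ be a Boolean doctrine, $\bar i,\bar j\in\mathbb{N}$, $Y_1,\dots,Y_{\bar i},Z_1,\dots,Z_{\bar j}\in\mathsf{C}$, $\alpha_i\in\mathbf{P}(Y_i)$ ($i=1,\dots,\bar i$) and $\beta_j\in\mathbf{P}(Z_j)$ ($j=1,\dots,\bar j$). The following are equivalent: (1) the universal filter generated by $\alpha_1,\dots,\alpha_{\bar i}$ intersects (in some component) the universal ideal generated by $\beta_1,\dots,\beta_{\bar j}$; (2) there are $n\in\mathbb{N}$, $l_1,\dots,l_n\in\{1,\dots,\bar i\}$ and morphisms $g_i\colon\prod_{j=1}^{\bar j}Z_j\to Y_{l_i}$ ($i=1,\dots,n$) such that in $\mathbf{P}(\prod_{j=1}^{\bar j}Z_j)$, $\bigwedge_{i=1}^n\mathbf{P}(g_i)(\alpha_{l_i})\le\bigvee_{j=1}^{\bar j}\mathbf{P}(\mathrm{pr}_j)(\beta_j)$.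
   Context: Categories have finite products; $\mathbf{t}$ terminal, $\mathrm{pr}_j$ projections. A Boolean doctrine is a functor $\mathbf{P}\colon\mathsf{C}^{\mathrm{op}}\to\mathsf{BA}$. A universal filter for $\mathbf{P}$ is a family $(F_X)_{X\in\mathsf{C}}$, $F_X\subseteq\mathbf{P}(X)$, with $\mathbf{P}(f)(\alpha)\in F_X$ for all $f\colon X\to Y$ and $\alpha\in F_Y$, and each $F_X$ a filter. A universal ideal is a family $(I_X)$, $I_X\subseteq\mathbf{P}(X)$, with: (i) for $m\in\mathbb{N}$, $f_1,\dots,f_m\colon X\to Y$, $\alpha\in\mathbf{P}(Y)$, if $\bigwedge_{j=1}^m\mathbf{P}(f_j)(\alpha)\in I_X$ then $\alpha\in I_Y$; (ii) each $I_X$ downward closed; (iii) $\alpha_1\in I_{X_1}$, $\alpha_2\in I_{X_2}$ imply $\mathbf{P}(\mathrm{pr}_1)(\alpha_1)\lor\mathbf{P}(\mathrm{pr}_2)(\alpha_2)\in I_{X_1\times X_2}$; (iv) $\bot_{\mathbf{P}(\mathbf{t})}\in I_{\mathbf{t}}$. The universal filter (resp. ideal) generated by given elements is the smallest universal filter (resp. ideal) containing them in the appropriate components. -}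

module Defs where

open import Level using (Level; _⊔_) renaming (suc to lsuc)
open import Data.Nat using (ℕ; zero; suc)
open import Data.Fin using (Fin; zero; suc)
open import Relation.Binary using (Rel; IsEquivalence)
open import Algebra.Lattice.Bundles using (BooleanAlgebra)

record Category (o h e : Level) : Set (lsuc (o ⊔ h ⊔ e)) where
  infixr 9 _∘_
  infix  3 _⇒_
  infix  4 _≈_
  field
    Obj       : Set o
    _⇒_       : Obj → Obj → Set h
    _≈_       : ∀ {A B} → Rel (A ⇒ B) e
    id        : ∀ {A} → A ⇒ A
    _∘_       : ∀ {A B C} → B ⇒ C → A ⇒ B → A ⇒ C
    ≈-equiv   : ∀ {A B} → IsEquivalence (_≈_ {A} {B})
    ∘-resp-≈  : ∀ {A B C} {f f′ : B ⇒ C} {g g′ : A ⇒ B} →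
                f ≈ f′ → g ≈ g′ → f ∘ g ≈ f′ ∘ g′
    identityˡ : ∀ {A B} {f : A ⇒ B} → id ∘ f ≈ f
    identityʳ : ∀ {A B} {f : A ⇒ B} → f ∘ id ≈ f
    assoc     : ∀ {A B C D} {f : A ⇒ B} {g : B ⇒ C} {k : C ⇒ D} →
                (k ∘ g) ∘ f ≈ k ∘ (g ∘ f)

record Cartesian (o h e : Level) : Set (lsuc (o ⊔ h ⊔ e)) where
  field
    category : Category o h e
  open Category category public
  infixr 7 _×_
  field
    t        : Obj
    !        : ∀ {A} → A ⇒ t
    !-unique : ∀ {A} (f : A ⇒ t) → f ≈ !
    _×_      : Obj → Obj → Obj
    pr₁      : ∀ {A B} → A × B ⇒ A
    pr₂      : ∀ {A B} → A × B ⇒ B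
    ⟨_,_⟩    : ∀ {X A B} → X ⇒ A → X ⇒ B → X ⇒ A × B
    pr₁-β    : ∀ {X A B} {f : X ⇒ A} {g : X ⇒ B} → pr₁ ∘ ⟨ f , g ⟩ ≈ f
    pr₂-β    : ∀ {X A B} {f : X ⇒ A} {g : X ⇒ B} → pr₂ ∘ ⟨ f , g ⟩ ≈ g
    ⟨⟩-unique : ∀ {X A B} {f : X ⇒ A} {g : X ⇒ B} {k : X ⇒ A × B} →
                pr₁ ∘ k ≈ f → pr₂ ∘ k ≈ g → k ≈ ⟨ f , g ⟩

  ∏ : ∀ n → (Fin n → Obj) → Obj
  ∏ zero Z = t
  ∏ (suc zero) Z = Z zero
  ∏ (suc (suc n)) Z = Z zero × ∏ (suc n) (λ j → Z (suc j))

  proj : ∀ {n} (Z : Fin n → Obj) (j : Fin n) → ∏ n Z ⇒ Z j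
  proj {suc zero} Z zero = id
  proj {suc (suc n)} Z zero = pr₁
  proj {suc (suc n)} Z (suc j) = proj (λ k → Z (suc k)) j ∘ pr₂

record Doctrine {o h e} (C : Cartesian o h e) (c ℓ : Level)
       : Set (o ⊔ h ⊔ e ⊔ lsuc (c ⊔ ℓ)) where
  open Cartesian C
  field
    P : Obj → BooleanAlgebra c ℓ
  module PX (X : Obj) = BooleanAlgebra (P X)
  open PX using (Carrier) public
  field
    map      : ∀ {X Y} → X ⇒ Y → Carrier Y → Carrier X
    map-cong : ∀ {X Y} (f : X ⇒ Y) {a b} → PX._≈_ Y a b → PX._≈_ X (map f a) (map f b)
    map-∧    : ∀ {X Y} (f : X ⇒ Y) a b →
               PX._≈_ X (map f (PX._∧_ Y a b)) (PX._∧_ X (map f a) (map f b))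
    map-∨    : ∀ {X Y} (f : X ⇒ Y) a b →
               PX._≈_ X (map f (PX._∨_ Y a b)) (PX._∨_ X (map f a) (map f b))
    map-¬    : ∀ {X Y} (f : X ⇒ Y) a →
               PX._≈_ X (map f (PX.¬_ Y a)) (PX.¬_ X (map f a))
    map-⊤    : ∀ {X Y} (f : X ⇒ Y) → PX._≈_ X (map f (PX.⊤ Y)) (PX.⊤ X)
    map-⊥    : ∀ {X Y} (f : X ⇒ Y) → PX._≈_ X (map f (PX.⊥ Y)) (PX.⊥ X)
    map-resp : ∀ {X Y} {f g : X ⇒ Y} → f ≈ g → ∀ a → PX._≈_ X (map f a) (map g a)
    map-id   : ∀ {X} a → PX._≈_ X (map (id {X}) a) a
    map-∘    : ∀ {X Y W} (f : X ⇒ Y) (g : Y ⇒ W) a →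
               PX._≈_ X (map (g ∘ f) a) (map f (map g a))

  Leq : ∀ X → Carrier X → Carrier X → Set ℓ
  Leq X a b = PX._≈_ X (PX._∧_ X a b) a

  ⋀ : ∀ {n} X → (Fin n → Carrier X) → Carrier X
  ⋀ {zero} X a = PX.⊤ X
  ⋀ {suc n} X a = PX._∧_ X (a zero) (⋀ X (λ i → a (suc i)))

  ⋁ : ∀ {n} X → (Fin n → Carrier X) → Carrier X
  ⋁ {zero} X a = PX.⊥ X
  ⋁ {suc n} X a = PX._∨_ X (a zero) (⋁ X (λ i → a (suc i)))

module _ {o h e c ℓ} {C : Cartesian o h e} (D : Doctrine C c ℓ) where
  open Cartesian C
  open Doctrine D

  ℓP : Level
  ℓP = o ⊔ h ⊔ e ⊔ c ⊔ ℓ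

  Family : Set (lsuc ℓP)
  Family = (X : Obj) → Carrier X → Set ℓP

  record IsUniversalFilter (F : Family) : Set ℓP where
    field
      stable : ∀ {X Y} (f : X ⇒ Y) {a} → F Y a → F X (map f a)
      top    : ∀ X → F X (PX.⊤ X)
      meet   : ∀ {X a b} → F X a → F X b → F X (PX._∧_ X a b)
      up     : ∀ {X a b} → F X a → Leq X a b → F X b

  record IsUniversalIdeal (I : Family) : Set ℓP where
    field
      reflect : ∀ {X Y} (m : ℕ) (f : Fin m → X ⇒ Y) (a : Carrier Y) →
                I X (⋀ X (λ j → map (f j) a)) → I Y a
      down    : ∀ {X a b} → I X a → Leq X b a → I X b
      join    : ∀ {X₁ X₂ a₁ a₂} → I X₁ a₁ → I X₂ a₂ →
                I (X₁ × X₂) (PX._∨_ (X₁ × X₂) (map pr₁ a₁) (map pr₂ a₂))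
      bot     : I t (PX.⊥ t)

  InGenFilter : ∀ {k} (Y : Fin k → Obj) (α : (i : Fin k) → Carrier (Y i)) →
                (X : Obj) → Carrier X → Set (lsuc ℓP)
  InGenFilter Y α X γ = (F : Family) → IsUniversalFilter F →
                        (∀ i → F (Y i) (α i)) → F X γ

  InGenIdeal : ∀ {k} (Z : Fin k → Obj) (β : (j : Fin k) → Carrier (Z j)) →
               (X : Obj) → Carrier X → Set (lsuc ℓP)
  InGenIdeal Z β X γ = (I : Family) → IsUniversalIdeal I →
                       (∀ j → I (Z j) (β j)) → I X γ

{-# OPTIONS --safe #-}
module Submission where

-- The universal filter generated by the αᵢ is explicit: over X it consists of the elements above
-- a finite meet of reindexings P(g)(αᵢ), g : X → Yᵢ.  Dually, for any universal filter F and any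
-- B ∈ P(Π), the γ ∈ P(X) such that finitely many reindexings P(f)(γ), f : Π → X, together with
-- an element of F_Π lie below B form a universal ideal (the join axiom is distributivity, over
-- all pairings ⟨f₁ , f₂⟩), and by modus ponens a γ in both F_X and this ideal forces B ∈ F_Π.
-- For F the generated filter, Π = ∏ Zⱼ and B = ⋁ P(prⱼ)(βⱼ) this ideal contains every βⱼ, so a
-- common element of the generated filter and ideal puts B into the generated filter, which is (2).
-- Conversely, the meet in (2) lies in every universal filter containing the αᵢ, and B lies in
-- every universal ideal containing the βⱼ.

open import Defs
open import Data.Nat using (ℕ)
open import Data.Fin using (Fin)
open import Data.Product using (Σ; _×_)
open import Function.Bundles using (_⇔_)

open import Level using (Level; Lift; lift)
open import Data.Nat using (zero; suc)
open import Data.Fin using (zero; suc)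
open import Data.Product using (_,_; proj₁; proj₂)
open import Data.List as List
  using (List; []; _∷_; _++_; [_]; concatMap; cartesianProductWith; tabulate; lookup; length)
open import Function.Bundles using (mk⇔)
open import Algebra.Lattice.Bundles using (BooleanAlgebra)
import Algebra.Lattice.Properties.BooleanAlgebra as BooleanAlgebraProperties
import Algebra.Lattice.Properties.Lattice as LatticeProperties
import Relation.Binary.Lattice as OrderLattice
import Relation.Binary.Lattice.Properties.MeetSemilattice as MeetSemilatticeProperties
import Relation.Binary.Reasoning.PartialOrder as PosetReasoning

module BooleanAlgebraOrder {c ℓ} (B : BooleanAlgebra c ℓ) where
  open BooleanAlgebra B public
  open BooleanAlgebraProperties B public using (∧-identityˡ; ∧-zeroˡ)
  private module O = OrderLattice.Lattice (LatticeProperties.∨-∧-orderTheoreticLattice lattice)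
  open O public
    using (_≤_; poset; x∧y≤x; x∧y≤y; x≤x∨y; y≤x∨y; ∨-least)
    renaming (refl to ≤-refl; reflexive to ≤-reflexive; trans to ≤-trans)
  open MeetSemilatticeProperties O.meetSemilattice public using (∧-monotonic)

  ⊥≤x : ∀ x → ⊥ ≤ x
  ⊥≤x x = sym (∧-zeroˡ x)

  x∧u≤z⇒y∧v≤z⇒[x∨y]∧[u∧v]≤z : ∀ {x y u v z} → x ∧ u ≤ z → y ∧ v ≤ z → (x ∨ y) ∧ (u ∧ v) ≤ z
  x∧u≤z⇒y∧v≤z⇒[x∨y]∧[u∧v]≤z {x} {y} {u} {v} {z} p q = begin
    (x ∨ y) ∧ (u ∧ v)             ≈⟨ ∧-distribʳ-∨ (u ∧ v) x y ⟩
    x ∧ (u ∧ v) ∨ y ∧ (u ∧ v)     ≤⟨ ∨-least (≤-trans (∧-monotonic ≤-refl (x∧y≤x u v)) p)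
                                              (≤-trans (∧-monotonic ≤-refl (x∧y≤y u v)) q) ⟩
    z                             ∎
    where open PosetReasoning poset

  private variable
    a a′ a″ : Level
    A : Set a
    A′ : Set a′
    A″ : Set a″

  ⋀ˡ : (A → Carrier) → List A → Carrier
  ⋀ˡ v []       = ⊤
  ⋀ˡ v (x ∷ xs) = v x ∧ ⋀ˡ v xs

  ⋀ˡ-++ : ∀ (v : A → Carrier) xs ys → ⋀ˡ v (xs ++ ys) ≈ ⋀ˡ v xs ∧ ⋀ˡ v ys
  ⋀ˡ-++ v []       ys = sym (∧-identityˡ (⋀ˡ v ys))
  ⋀ˡ-++ v (x ∷ xs) ys = trans (∧-congˡ (⋀ˡ-++ v xs ys)) (sym (∧-assoc _ _ _))

  ⋀ˡ-map : ∀ (v : A′ → Carrier) (g : A → A′) xs → ⋀ˡ v (List.map g xs) ≈ ⋀ˡ (λ x → v (g x)) xs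
  ⋀ˡ-map v g []       = refl
  ⋀ˡ-map v g (x ∷ xs) = ∧-congˡ (⋀ˡ-map v g xs)

  ⋀ˡ-concatMap : ∀ (v : A′ → Carrier) (g : A → List A′) xs →
                 ⋀ˡ v (concatMap g xs) ≈ ⋀ˡ (λ x → ⋀ˡ v (g x)) xs
  ⋀ˡ-concatMap v g []       = refl
  ⋀ˡ-concatMap v g (x ∷ xs) = trans (⋀ˡ-++ v (g x) (concatMap g xs)) (∧-congˡ (⋀ˡ-concatMap v g xs))

  ⋀ˡ-mono : ∀ {v w : A → Carrier} → (∀ x → v x ≤ w x) → ∀ xs → ⋀ˡ v xs ≤ ⋀ˡ w xs
  ⋀ˡ-mono v≤w []       = ≤-refl
  ⋀ˡ-mono v≤w (x ∷ xs) = ∧-monotonic (v≤w x) (⋀ˡ-mono v≤w xs)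

  ⋀ˡ-∨ˡ : ∀ {v w : A → Carrier} {x} → (∀ y → v y ≤ x ∨ w y) → ∀ ys → ⋀ˡ v ys ≤ x ∨ ⋀ˡ w ys
  ⋀ˡ-∨ˡ             v≤x∨w []       = y≤x∨y _ ⊤
  ⋀ˡ-∨ˡ {v = v} {w} {x} v≤x∨w (y ∷ ys) = begin
    v y ∧ ⋀ˡ v ys               ≤⟨ ∧-monotonic (v≤x∨w y) (⋀ˡ-∨ˡ v≤x∨w ys) ⟩
    (x ∨ w y) ∧ (x ∨ ⋀ˡ w ys)   ≈⟨ ∨-distribˡ-∧ x (w y) (⋀ˡ w ys) ⟨
    x ∨ (w y ∧ ⋀ˡ w ys)         ∎
    where open PosetReasoning poset

  ⋀ˡ-cartesianProductWith : ∀ {k : A → A′ → A″} {v : A″ → Carrier} {u : A → Carrier}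
                              {w : A′ → Carrier} →
                            (∀ x y → v (k x y) ≤ u x ∨ w y) →
                            ∀ xs ys → ⋀ˡ v (cartesianProductWith k xs ys) ≤ ⋀ˡ u xs ∨ ⋀ˡ w ys
  ⋀ˡ-cartesianProductWith         v≤u∨w []       ys = x≤x∨y ⊤ _
  ⋀ˡ-cartesianProductWith {k = k} {v} {u} {w} v≤u∨w (x ∷ xs) ys = begin
    ⋀ˡ v (List.map (k x) ys ++ cartesianProductWith k xs ys)
      ≈⟨ ⋀ˡ-++ v (List.map (k x) ys) (cartesianProductWith k xs ys) ⟩
    ⋀ˡ v (List.map (k x) ys) ∧ ⋀ˡ v (cartesianProductWith k xs ys)
      ≤⟨ ∧-monotonic row (⋀ˡ-cartesianProductWith v≤u∨w xs ys) ⟩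
    (u x ∨ ⋀ˡ w ys) ∧ (⋀ˡ u xs ∨ ⋀ˡ w ys)
      ≈⟨ ∨-distribʳ-∧ (⋀ˡ w ys) (u x) (⋀ˡ u xs) ⟨
    u x ∧ ⋀ˡ u xs ∨ ⋀ˡ w ys
      ∎
    where
    open PosetReasoning poset
    row : ⋀ˡ v (List.map (k x) ys) ≤ u x ∨ ⋀ˡ w ys
    row = ≤-trans (≤-reflexive (⋀ˡ-map v (k x) ys)) (⋀ˡ-∨ˡ (v≤u∨w x) ys)

module _ {o h e c ℓ} {C : Cartesian o h e} (D : Doctrine C c ℓ) where
  open Cartesian C hiding (_≈_; _×_)
  open Doctrine D
  open module 𝐏 {X : Obj} = BooleanAlgebraOrder (P X) hiding (Carrier)

  -- Leq orders by a ∧ b ≈ a, the library lattice order by a ≈ a ∧ b.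
  Leq⇒≤ : ∀ {X} {a b : Carrier X} → Leq X a b → a ≤ b
  Leq⇒≤ = sym

  ≤⇒Leq : ∀ {X} {a b : Carrier X} → a ≤ b → Leq X a b
  ≤⇒Leq = sym

  map-mono : ∀ {X Y} (f : X ⇒ Y) {a b : Carrier Y} → a ≤ b → map f a ≤ map f b
  map-mono f {a} {b} a≤b = trans (map-cong f a≤b) (map-∧ f a b)

  ⋁-upper : ∀ {n X} (a : Fin n → Carrier X) j → a j ≤ ⋁ X a
  ⋁-upper a zero    = x≤x∨y _ _
  ⋁-upper a (suc j) = ≤-trans (⋁-upper (λ i → a (suc i)) j) (y≤x∨y _ _)

  ⋁-least : ∀ {n X} {a : Fin n → Carrier X} {x} → (∀ j → a j ≤ x) → ⋁ X a ≤ x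
  ⋁-least {zero}  a≤x = ⊥≤x _
  ⋁-least {suc n} a≤x = ∨-least (a≤x zero) (⋁-least (λ j → a≤x (suc j)))

  ⋀-lookup : ∀ {X a} {A : Set a} (v : A → Carrier X) xs → ⋀ X (λ i → v (lookup xs i)) ≈ ⋀ˡ v xs
  ⋀-lookup v []       = refl
  ⋀-lookup v (x ∷ xs) = ∧-congˡ (⋀-lookup v xs)

  map-⟨,⟩-∨ : ∀ {W X₁ X₂} (f₁ : W ⇒ X₁) (f₂ : W ⇒ X₂) a₁ a₂ →
              map ⟨ f₁ , f₂ ⟩ (map pr₁ a₁ ∨ map pr₂ a₂) ≈ map f₁ a₁ ∨ map f₂ a₂
  map-⟨,⟩-∨ f₁ f₂ a₁ a₂ = trans (map-∨ _ _ _)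
    (∨-cong (trans (sym (map-∘ _ pr₁ a₁)) (map-resp pr₁-β a₁))
            (trans (sym (map-∘ _ pr₂ a₂)) (map-resp pr₂-β a₂)))

  ⋀map : ∀ {X W} → List (X ⇒ W) → Carrier W → Carrier X
  ⋀map fs a = ⋀ˡ (λ f → map f a) fs

  ⋀map-mono : ∀ {X W} (fs : List (X ⇒ W)) {a b} → a ≤ b → ⋀map fs a ≤ ⋀map fs b
  ⋀map-mono fs a≤b = ⋀ˡ-mono (λ f → map-mono f a≤b) fs

  ⋀map-tabulate-∘ : ∀ {m W X Y} (f : Fin m → X ⇒ Y) (g : W ⇒ X) a →
                    ⋀map (tabulate (λ j → f j ∘ g)) a ≈ map g (⋀ X (λ j → map (f j) a))
  ⋀map-tabulate-∘ {zero}  f g a = sym (map-⊤ g)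
  ⋀map-tabulate-∘ {suc m} f g a =
    trans (∧-cong (map-∘ g (f zero) a) (⋀map-tabulate-∘ (λ j → f (suc j)) g a)) (sym (map-∧ g _ _))

  ⋁π : ∀ {n} (Z : Fin n → Obj) → ((j : Fin n) → Carrier (Z j)) → Carrier (∏ n Z)
  ⋁π {n} Z β = ⋁ (∏ n Z) (λ j → map (proj Z j) (β j))

  ⋁π-least : ∀ {n} (Z : Fin n → Obj) β {x} → (∀ j → map (proj Z j) (β j) ≤ x) → ⋁π Z β ≤ x
  ⋁π-least Z β = ⋁-least

  ⋁π∈ : ∀ {I} → IsUniversalIdeal D I →
        ∀ {n} (Z : Fin n → Obj) β → (∀ j → I (Z j) (β j)) → I (∏ n Z) (⋁π Z β)
  ⋁π∈ isI {zero}        Z β β∈I = IsUniversalIdeal.bot isI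
  ⋁π∈ isI {suc zero}    Z β β∈I =
    IsUniversalIdeal.down isI (β∈I zero) (≤⇒Leq (⋁π-least Z β λ { zero → ≤-reflexive (map-id _) }))
  ⋁π∈ isI {suc (suc n)} Z β β∈I =
    down (join (β∈I zero) (⋁π∈ isI {suc n} Z′ β′ (λ j → β∈I (suc j))))
         (≤⇒Leq (⋁π-least Z β component≤))
    where
    open IsUniversalIdeal isI
    Z′ : Fin (suc n) → Obj
    Z′ j = Z (suc j)
    β′ : ∀ j → Carrier (Z′ j)
    β′ j = β (suc j)
    component≤ : ∀ j → map (proj Z j) (β j) ≤ map pr₁ (β zero) ∨ map pr₂ (⋁π Z′ β′)
    component≤ zero    = x≤x∨y _ _
    component≤ (suc j) = begin
      map (proj Z′ j ∘ pr₂) (β′ j)          ≈⟨ map-∘ pr₂ (proj Z′ j) (β′ j) ⟩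
      map pr₂ (map (proj Z′ j) (β′ j))      ≤⟨ map-mono pr₂ (⋁-upper (λ i → map (proj Z′ i) (β′ i)) j) ⟩
      map pr₂ (⋁π Z′ β′)                    ≤⟨ y≤x∨y _ _ ⟩
      map pr₁ (β zero) ∨ map pr₂ (⋁π Z′ β′) ∎
      where open PosetReasoning poset

  module _ {k} (Y : Fin k → Obj) (α : (i : Fin k) → Carrier (Y i)) where

    ⋀-reindexed∈ : ∀ {F} → IsUniversalFilter D F → (∀ i → F (Y i) (α i)) →
                   ∀ {n X} (l : Fin n → Fin k) (g : (i : Fin n) → X ⇒ Y (l i)) →
                   F X (⋀ X (λ i → map (g i) (α (l i))))
    ⋀-reindexed∈ isF α∈F {zero}  {X} l g = IsUniversalFilter.top isF X
    ⋀-reindexed∈ isF α∈F {suc n}     l g = IsUniversalFilter.meet isF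
      (IsUniversalFilter.stable isF (g zero) (α∈F (l zero)))
      (⋀-reindexed∈ isF α∈F (λ i → l (suc i)) (λ i → g (suc i)))

    Reindexing : Obj → Set h
    Reindexing X = Σ (Fin k) (λ i → X ⇒ Y i)

    ⟦_⟧ : ∀ {X} → Reindexing X → Carrier X
    ⟦ i , g ⟧ = map g (α i)

    _∘ʳ_ : ∀ {X W} → Reindexing W → X ⇒ W → Reindexing X
    (i , g) ∘ʳ f = i , g ∘ f

    ⋀⟦⟧-∘ʳ : ∀ {X W} (f : X ⇒ W) rs → ⋀ˡ ⟦_⟧ (List.map (_∘ʳ f) rs) ≈ map f (⋀ˡ ⟦_⟧ rs)
    ⋀⟦⟧-∘ʳ f []             = sym (map-⊤ f)
    ⋀⟦⟧-∘ʳ f ((i , g) ∷ rs) = trans (∧-cong (map-∘ f g (α i)) (⋀⟦⟧-∘ʳ f rs)) (sym (map-∧ f _ _))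

    GeneratedFilter : Family D
    GeneratedFilter X γ = Lift (ℓP D) (Σ (List (Reindexing X)) (λ rs → ⋀ˡ ⟦_⟧ rs ≤ γ))

    generatedFilter-isUniversalFilter : IsUniversalFilter D GeneratedFilter
    generatedFilter-isUniversalFilter = record
      { stable = λ f (lift (rs , p)) →
          lift (List.map (_∘ʳ f) rs , ≤-trans (≤-reflexive (⋀⟦⟧-∘ʳ f rs)) (map-mono f p))
      ; top    = λ X → lift ([] , ≤-refl)
      ; meet   = λ (lift (rs , p)) (lift (ss , q)) →
          lift (rs ++ ss , ≤-trans (≤-reflexive (⋀ˡ-++ ⟦_⟧ rs ss)) (∧-monotonic p q))
      ; up     = λ (lift (rs , p)) q → lift (rs , ≤-trans p (Leq⇒≤ q))
      }

    generator∈GeneratedFilter : ∀ i → GeneratedFilter (Y i) (α i)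
    generator∈GeneratedFilter i = lift ([ i , id ] , ≤-trans (x∧y≤x _ _) (≤-reflexive (map-id (α i))))

    GeneratedFilter⇒⋀-reindexed≤ :
      ∀ {X γ} → GeneratedFilter X γ →
      Σ ℕ (λ n → Σ (Fin n → Fin k) (λ l → Σ ((i : Fin n) → X ⇒ Y (l i)) (λ g →
        Leq X (⋀ X (λ i → map (g i) (α (l i)))) γ)))
    GeneratedFilter⇒⋀-reindexed≤ (lift (rs , p)) =
      length rs , (λ i → proj₁ (lookup rs i)) , (λ i → proj₂ (lookup rs i)) ,
      ≤⇒Leq (≤-trans (≤-reflexive (⋀-lookup ⟦_⟧ rs)) p)

  EntailsModulo : Family D → ∀ {Π} → Carrier Π → Family D
  EntailsModulo F {Π} B X γ =
    Σ (List (Π ⇒ X)) (λ fs → Σ (Carrier Π) (λ c → F Π c × ⋀map fs γ ∧ c ≤ B))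

  module _ {F} (isF : IsUniversalFilter D F) {Π} (B : Carrier Π) where
    open IsUniversalFilter isF

    ⋀map∈F : ∀ {X γ} → F X γ → (fs : List (Π ⇒ X)) → F Π (⋀map fs γ)
    ⋀map∈F γ∈F []       = top Π
    ⋀map∈F γ∈F (f ∷ fs) = meet (stable f γ∈F) (⋀map∈F γ∈F fs)

    modusPonens : ∀ {X γ} → F X γ → EntailsModulo F B X γ → F Π B
    modusPonens γ∈F (fs , c , c∈F , p) = up (meet (⋀map∈F γ∈F fs) c∈F) (≤⇒Leq p)

    reindexed≤⇒EntailsModulo : ∀ {X} (f : Π ⇒ X) {γ} → map f γ ≤ B → EntailsModulo F B X γ
    reindexed≤⇒EntailsModulo f p = [ f ] , ⊤ , top Π , ≤-trans (x∧y≤x _ _) (≤-trans (x∧y≤x _ _) p)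

    entailsModulo-isUniversalIdeal : IsUniversalIdeal D (EntailsModulo F B)
    entailsModulo-isUniversalIdeal = record
      { reflect = λ m f a (fs , c , c∈F , p) →
          concatMap (λ g → tabulate (λ j → f j ∘ g)) fs , c , c∈F ,
          ≤-trans (∧-monotonic (⋀map-concatMap-tabulate f a fs) ≤-refl) p
      ; down    = λ (fs , c , c∈F , p) b≤a →
          fs , c , c∈F , ≤-trans (∧-monotonic (⋀map-mono fs (Leq⇒≤ b≤a)) ≤-refl) p
      ; join    = λ { {a₁ = a₁} {a₂} (fs₁ , c₁ , c₁∈F , p₁) (fs₂ , c₂ , c₂∈F , p₂) →
          cartesianProductWith ⟨_,_⟩ fs₁ fs₂ , c₁ ∧ c₂ , meet c₁∈F c₂∈F ,
          ≤-trans (∧-monotonic (⋀map-pairing-∨ a₁ a₂ fs₁ fs₂) ≤-refl)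
                  (x∧u≤z⇒y∧v≤z⇒[x∨y]∧[u∧v]≤z p₁ p₂) }
      ; bot     = reindexed≤⇒EntailsModulo ! (≤-trans (≤-reflexive (map-⊥ !)) (⊥≤x B))
      }
      where
      ⋀map-concatMap-tabulate : ∀ {m X Y} (f : Fin m → X ⇒ Y) a (fs : List (Π ⇒ X)) →
        ⋀map (concatMap (λ g → tabulate (λ j → f j ∘ g)) fs) a ≤ ⋀map fs (⋀ X (λ j → map (f j) a))
      ⋀map-concatMap-tabulate f a fs =
        ≤-trans (≤-reflexive (⋀ˡ-concatMap _ _ fs))
                (⋀ˡ-mono (λ g → ≤-reflexive (⋀map-tabulate-∘ f g a)) fs)
      ⋀map-pairing-∨ : ∀ {X₁ X₂} a₁ a₂ (fs₁ : List (Π ⇒ X₁)) (fs₂ : List (Π ⇒ X₂)) →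
        ⋀map (cartesianProductWith ⟨_,_⟩ fs₁ fs₂) (map pr₁ a₁ ∨ map pr₂ a₂) ≤ ⋀map fs₁ a₁ ∨ ⋀map fs₂ a₂
      ⋀map-pairing-∨ a₁ a₂ =
        ⋀ˡ-cartesianProductWith (λ f₁ f₂ → ≤-reflexive (map-⟨,⟩-∨ f₁ f₂ a₁ a₂))

lemma3p16 : ∀ {o h e c ℓ} (C : Cartesian o h e) (D : Doctrine C c ℓ)
              (ī j̄ : ℕ) (Y : Fin ī → Cartesian.Obj C) (Z : Fin j̄ → Cartesian.Obj C)
              (α : (i : Fin ī) → Doctrine.Carrier D (Y i))
              (β : (j : Fin j̄) → Doctrine.Carrier D (Z j)) →
            (Σ (Cartesian.Obj C) (λ X → Σ (Doctrine.Carrier D X) (λ γ →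
                InGenFilter D Y α X γ × InGenIdeal D Z β X γ)))
            ⇔
            (Σ ℕ (λ n → Σ (Fin n → Fin ī) (λ l →
               Σ ((i : Fin n) → Cartesian._⇒_ C (Cartesian.∏ C j̄ Z) (Y (l i))) (λ g →
                 Doctrine.Leq D (Cartesian.∏ C j̄ Z)
                   (Doctrine.⋀ D (Cartesian.∏ C j̄ Z) (λ i → Doctrine.map D (g i) (α (l i))))
                   (Doctrine.⋁ D (Cartesian.∏ C j̄ Z) (λ j → Doctrine.map D (Cartesian.proj C Z j) (β j)))))))
lemma3p16 C D ī j̄ Y Z α β = mk⇔
  (λ (X , γ , γ∈⟨α⟩ , γ∈⟨β⟩) →
    let γ∈F = γ∈⟨α⟩ (GeneratedFilter D Y α) isF (generator∈GeneratedFilter D Y α)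
        γ∈I = γ∈⟨β⟩ (EntailsModulo D (GeneratedFilter D Y α) B) (entailsModulo-isUniversalIdeal D isF B)
                     (λ j → reindexed≤⇒EntailsModulo D isF B (proj Z j) (⋁-upper D _ j))
    in GeneratedFilter⇒⋀-reindexed≤ D Y α (modusPonens D isF B γ∈F γ∈I))
  (λ (n , l , g , p) →
    ∏ j̄ Z , _ ,
    (λ F isF′ α∈F → ⋀-reindexed∈ D Y α isF′ α∈F l g) ,
    (λ I isI β∈I → IsUniversalIdeal.down isI (⋁π∈ D isI Z β β∈I) p))
  where
  open Cartesian C using (∏; proj)
  isF : IsUniversalFilter D (GeneratedFilter D Y α)
  isF = generatedFilter-isUniversalFilter D Y α
  B : Doctrine.Carrier D (∏ j̄ Z)
  B = ⋁π D Z β
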